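{- Let $D$ be a dendriform algebra over a field $k$ of characteristic zero and $\overline D=D\oplus k\mathbf 1$ its unital augmentation. Let $a,b\in D$ and let $Z\in\overline D[[\lambda]]$ satisfy $Z=\mathbf 1+\lambda\, Z\succ b$. Then $$X:=Z^{ -1}*\bigl(Z\succ a\prec Z^{ -1}\bigr)*Z$$ is a solution of the equation $X=a+\lambda\, X\rhd b$ in $\overline D[[\lambda]]$.
   Context: A dendriform algebra over $k$ is a $k$-vector space $D$ with bilinear operations $\prec,\succ$ such that for all $a,b,c\in D$: $(a\prec b)\prec c=a\prec(b\prec c+b\succ c)$, $(a\succ b)\prec c=a\succ(b\prec c)$, $a\succ(b\succ c)=(a\prec b+a\succ b)\succ c$. The product $a*b:=a\prec b+a\succ b$ is associative, and $a\rhd b:=a\succ b-b\prec a$ is the associated left pre-Lie product. The augmentation $\overline D=D\oplus k\mathbf 1$ is defined by $a\prec\mathbf 1=a=\mathbf 1\succ a$ and $\mathbf 1\prec a=0=a\succ\mathbf 1$ for $a\in D$ ($\mathbf 1\prec\mathbf 1$, $\mathbf 1\succ\mathbf 1$ undefined), with $\mathbf 1*\mathbf 1=\mathbf 1$. Operations extend $\lambda$-bilinearly to $\overline D[[\lambda]]$; $W^{ -1}$ is the $*$-inverse of $W$ with constant term $\mathbf 1$, and $Z\succ a\prec Z^{ -1}:=(Z\succ a)\prec Z^{ -1}=Z\succ(a\prec Z^{ -1})$. -}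

module Defs where

open import Level using (Level; _⊔_) renaming (suc to lsuc)
open import Data.Nat using (ℕ; zero; suc; _∸_)
open import Data.Product using (_×_; _,_; proj₁; proj₂; ∃)
open import Relation.Nullary using (¬_)
open import Relation.Binary.PropositionalEquality using (_≡_)
open import Algebra.Bundles using (CommutativeRing)
open import Algebra.Module.Bundles using (Module)

record Field (c ℓ : Level) : Set (lsuc (c ⊔ ℓ)) where
  field
    commutativeRing : CommutativeRing c ℓ
  open CommutativeRing commutativeRing public
  field
    0≉1     : ¬ (0# ≈ 1#)
    inverse : ∀ x → ¬ (x ≈ 0#) → ∃ λ y → (x * y) ≈ 1#

  fromℕ : ℕ → Carrier
  fromℕ zero    = 0#
  fromℕ (suc n) = 1# + fromℕ n

CharZero : ∀ {c ℓ} → Field c ℓ → Set ℓ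
CharZero F = ∀ n → Field._≈_ F (Field.fromℕ F n) (Field.0# F) → n ≡ 0

record Dendriform {c ℓ : Level} (F : Field c ℓ) (m ℓm : Level)
       : Set (c ⊔ ℓ ⊔ lsuc (m ⊔ ℓm)) where
  open Field F using (commutativeRing)
  field
    vectorSpace : Module commutativeRing m ℓm
  open Module vectorSpace public
  infixl 7 _≺_ _≻_
  field
    _≺_ _≻_ : Carrierᴹ → Carrierᴹ → Carrierᴹ
    ≺-cong : ∀ {x x' y y'} → x ≈ᴹ x' → y ≈ᴹ y' → (x ≺ y) ≈ᴹ (x' ≺ y')
    ≻-cong : ∀ {x x' y y'} → x ≈ᴹ x' → y ≈ᴹ y' → (x ≻ y) ≈ᴹ (x' ≻ y')
    ≺-distribˡ : ∀ x y z → (x ≺ (y +ᴹ z)) ≈ᴹ ((x ≺ y) +ᴹ (x ≺ z))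
    ≺-distribʳ : ∀ x y z → ((y +ᴹ z) ≺ x) ≈ᴹ ((y ≺ x) +ᴹ (z ≺ x))
    ≻-distribˡ : ∀ x y z → (x ≻ (y +ᴹ z)) ≈ᴹ ((x ≻ y) +ᴹ (x ≻ z))
    ≻-distribʳ : ∀ x y z → ((y +ᴹ z) ≻ x) ≈ᴹ ((y ≻ x) +ᴹ (z ≻ x))
    ≺-scalarˡ  : ∀ r x y → ((r *ₗ x) ≺ y) ≈ᴹ (r *ₗ (x ≺ y))
    ≺-scalarʳ  : ∀ r x y → (x ≺ (r *ₗ y)) ≈ᴹ (r *ₗ (x ≺ y))
    ≻-scalarˡ  : ∀ r x y → ((r *ₗ x) ≻ y) ≈ᴹ (r *ₗ (x ≻ y))
    ≻-scalarʳ  : ∀ r x y → (x ≻ (r *ₗ y)) ≈ᴹ (r *ₗ (x ≻ y))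
    dend₁ : ∀ a b c → ((a ≺ b) ≺ c) ≈ᴹ (a ≺ ((b ≺ c) +ᴹ (b ≻ c)))
    dend₂ : ∀ a b c → ((a ≻ b) ≺ c) ≈ᴹ (a ≻ (b ≺ c))
    dend₃ : ∀ a b c → (a ≻ (b ≻ c)) ≈ᴹ (((a ≺ b) +ᴹ (a ≻ b)) ≻ c)

-- An element (α , x) of D̄ stands for α·1 + x.
-- Only the operations that are defined are implemented:
--   ≻ : D̄ × D → D   with 1 ≻ x = x
--   ≺ : D × D̄ → D   with x ≺ 1 = x
--   * : D̄ × D̄ → D̄  (total, 1*1 = 1, 1*x = x = x*1)
-- A formal power series in λ with coefficients in V is a function ℕ → V
-- (the n-th coefficient); operations are extended λ-bilinearly
-- (Cauchy product).

module Augmented {c ℓ m ℓm : Level} {F : Field c ℓ} (D : Dendriform F m ℓm) where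
  open Field F using (Carrier; _≈_; _+_; _*_; 0#; 1#)
  open Dendriform D

  D̄ : Set (c ⊔ m)
  D̄ = Carrier × Carrierᴹ

  _≈̄_ : D̄ → D̄ → Set (ℓ ⊔ ℓm)
  (α , x) ≈̄ (β , y) = (α ≈ β) × (x ≈ᴹ y)

  _+̄_ : D̄ → D̄ → D̄
  (α , x) +̄ (β , y) = (α + β , x +ᴹ y)

  0̄ 1̄ : D̄
  0̄ = (0# , 0ᴹ)
  1̄ = (1# , 0ᴹ)

  ι : Carrierᴹ → D̄
  ι x = (0# , x)

  _≻̄_ : D̄ → Carrierᴹ → Carrierᴹ
  (α , x) ≻̄ y = (α *ₗ y) +ᴹ (x ≻ y)

  _≺̄_ : Carrierᴹ → D̄ → Carrierᴹ
  x ≺̄ (β , y) = (β *ₗ x) +ᴹ (x ≺ y)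

  -- (α1 + x) * (β1 + y) = αβ 1 + (α y + β x + x ≺ y + x ≻ y)
  _*̄_ : D̄ → D̄ → D̄
  (α , x) *̄ (β , y) =
    (α * β , ((α *ₗ y) +ᴹ (β *ₗ x)) +ᴹ ((x ≺ y) +ᴹ (x ≻ y)))

  sumᴹ : ℕ → (ℕ → Carrierᴹ) → Carrierᴹ
  sumᴹ zero    f = f 0
  sumᴹ (suc n) f = sumᴹ n f +ᴹ f (suc n)

  sum̄ : ℕ → (ℕ → D̄) → D̄
  sum̄ zero    f = f 0
  sum̄ (suc n) f = sum̄ n f +̄ f (suc n)

  Ser : Set (c ⊔ m)
  Ser = ℕ → D̄

  SerD : Set m
  SerD = ℕ → Carrierᴹ

  infix 4 _≈ˢ_
  _≈ˢ_ : Ser → Ser → Set (ℓ ⊔ ℓm)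
  X ≈ˢ Y = ∀ n → X n ≈̄ Y n

  _+ˢ_ : Ser → Ser → Ser
  (X +ˢ Y) n = X n +̄ Y n

  _+ᴰ_ _-ᴰ_ : SerD → SerD → SerD
  (A +ᴰ B) n = A n +ᴹ B n
  (A -ᴰ B) n = A n +ᴹ (-ᴹ B n)

  oneˢ : Ser
  oneˢ zero    = 1̄
  oneˢ (suc n) = 0̄

  constᴰ : Carrierᴹ → SerD
  constᴰ a zero    = a
  constᴰ a (suc n) = 0ᴹ

  ιˢ : SerD → Ser
  ιˢ A n = ι (A n)

  λ·_ : SerD → SerD
  (λ· A) zero    = 0ᴹ
  (λ· A) (suc n) = A n

  infixl 7 _*ˢ_ _≻ˢ_ _≺ˢ_
  _*ˢ_ : Ser → Ser → Ser
  (X *ˢ Y) n = sum̄ n (λ i → X i *̄ Y (n ∸ i))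

  _≻ˢ_ : Ser → SerD → SerD
  (X ≻ˢ A) n = sumᴹ n (λ i → X i ≻̄ A (n ∸ i))

  _≺ˢ_ : SerD → Ser → SerD
  (A ≺ˢ X) n = sumᴹ n (λ i → A i ≺̄ X (n ∸ i))

  _▷ˢ_ : Ser → SerD → SerD
  X ▷ˢ B = (X ≻ˢ B) -ᴰ (B ≺ˢ X)

-- Extend ≺ and ≻ to total bilinear operations ≺̃, ≻̃ on D̄ by putting 1 ≺ 1 = 1 ≻ 1 = 0.
-- Then p * q = (k·1-part) + p ≺̃ q + p ≻̃ q, and the three dendriform axioms hold on all
-- of D̄, hence (by Cauchy convolution) on D̄[[λ]].  Put W = (Z ≻ a) ≺ Z⁻¹ and V = W * Z,
-- so that X = Z⁻¹ * V.  As W has no k·1-part, V = W ≺ Z + W ≻ Z, and since the D-part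
-- of Z is λ Z ≻ b this gives V = Z ≻ a + λ V ≻ b.  Comparing D-parts in Z⁻¹ * Z = 1
-- gives Z⁻¹ ≺ Z = − Z⁻¹ ≻ Z = − λ b, so X = Z⁻¹ ≺ V + Z⁻¹ ≻ V with
-- Z⁻¹ ≺ V = (Z⁻¹ ≺ Z) ≺ X = − λ b ≺ X  and  Z⁻¹ ≻ V = a + λ X ≻ b.

module Submission where

open import Level using (_⊔_)
open import Data.Nat using (ℕ; zero; suc; _∸_)
open import Data.Product using (_×_; _,_)
open import Function using (_∘_)
open import Algebra.Bundles using (AbelianGroup; CommutativeMonoid)
import Algebra.Construct.DirectProduct as DirectProduct
import Algebra.Construct.Pointwise as Pointwise
import Algebra.Properties.AbelianGroup as AbelianGroupProperties
import Algebra.Properties.CommutativeSemigroup as CommutativeSemigroupProperties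
import Algebra.Properties.Group as GroupProperties
import Algebra.Solver.CommutativeMonoid as CommutativeMonoidSolver
import Relation.Binary.Reasoning.Setoid as SetoidReasoning

open import Defs

module Convolution {a ℓ} (G : AbelianGroup a ℓ) where
  open AbelianGroup G
  open GroupProperties group using (identityˡ-unique; inverseˡ-unique; ε⁻¹≈ε)
  open AbelianGroupProperties G using (⁻¹-∙-comm)
  open CommutativeSemigroupProperties commutativeSemigroup using (interchange)
  open SetoidReasoning setoid

  sum : ℕ → (ℕ → Carrier) → Carrier
  sum zero    f = f 0
  sum (suc n) f = sum n f ∙ f (suc n)

  sum-cong : ∀ n {f g : ℕ → Carrier} → (∀ i → f i ≈ g i) → sum n f ≈ sum n g
  sum-cong zero    f≈g = f≈g 0
  sum-cong (suc n) f≈g = ∙-cong (sum-cong n f≈g) (f≈g (suc n))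

  sum-ε : ∀ n {f : ℕ → Carrier} → (∀ i → f i ≈ ε) → sum n f ≈ ε
  sum-ε zero    f≈ε = f≈ε 0
  sum-ε (suc n) f≈ε = trans (∙-cong (sum-ε n f≈ε) (f≈ε (suc n))) (identityˡ ε)

  sum-∙ : ∀ n (f g : ℕ → Carrier) → sum n (λ i → f i ∙ g i) ≈ sum n f ∙ sum n g
  sum-∙ zero    f g = refl
  sum-∙ (suc n) f g = trans (∙-congʳ (sum-∙ n f g)) (interchange _ _ _ _)

  sum-suc : ∀ n (f : ℕ → Carrier) → sum (suc n) f ≈ f 0 ∙ sum n (f ∘ suc)
  sum-suc zero    f = refl
  sum-suc (suc n) f = trans (∙-congʳ (sum-suc n f)) (assoc _ _ _)

  sum-homo : (h : Carrier → Carrier) → (∀ {x y} → x ≈ y → h x ≈ h y) →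
             (∀ x y → h (x ∙ y) ≈ h x ∙ h y) →
             ∀ n (f : ℕ → Carrier) → h (sum n f) ≈ sum n (h ∘ f)
  sum-homo h h-cong h-∙ zero    f = refl
  sum-homo h h-cong h-∙ (suc n) f =
    trans (h-∙ _ _) (∙-cong (sum-homo h h-cong h-∙ n f) refl)

  record Bilinear (f : Carrier → Carrier → Carrier) : Set (a ⊔ ℓ) where
    field
      cong     : ∀ {x x′ y y′} → x ≈ x′ → y ≈ y′ → f x y ≈ f x′ y′
      distribˡ : ∀ x y z → f x (y ∙ z) ≈ f x y ∙ f x z
      distribʳ : ∀ x y z → f (y ∙ z) x ≈ f y x ∙ f z x

    zeroˡ : ∀ y → f ε y ≈ ε
    zeroˡ y = identityˡ-unique _ _
      (trans (sym (distribʳ y ε ε)) (cong (identityˡ ε) refl))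

    zeroʳ : ∀ x → f x ε ≈ ε
    zeroʳ x = identityˡ-unique _ _
      (trans (sym (distribˡ x ε ε)) (cong refl (identityˡ ε)))

    ⁻¹-homoˡ : ∀ x y → f (x ⁻¹) y ≈ f x y ⁻¹
    ⁻¹-homoˡ x y = inverseˡ-unique _ _
      (trans (sym (distribʳ y _ _)) (trans (cong (inverseˡ x) refl) (zeroˡ y)))

  Bilinear-∙ : ∀ {f g} → Bilinear f → Bilinear g → Bilinear (λ x y → f x y ∙ g x y)
  Bilinear-∙ f-bilinear g-bilinear = record
    { cong     = λ x≈x′ y≈y′ → ∙-cong (F.cong x≈x′ y≈y′) (G.cong x≈x′ y≈y′)
    ; distribˡ = λ x y z → trans (∙-cong (F.distribˡ x y z) (G.distribˡ x y z)) (interchange _ _ _ _)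
    ; distribʳ = λ x y z → trans (∙-cong (F.distribʳ x y z) (G.distribʳ x y z)) (interchange _ _ _ _)
    }
    where module F = Bilinear f-bilinear
          module G = Bilinear g-bilinear

  Bilinear-resp : ∀ {f g} → (∀ x y → f x y ≈ g x y) → Bilinear f → Bilinear g
  Bilinear-resp f≈g f-bilinear = record
    { cong     = λ x≈x′ y≈y′ → trans (sym (f≈g _ _)) (trans (F.cong x≈x′ y≈y′) (f≈g _ _))
    ; distribˡ = λ x y z → trans (sym (f≈g _ _)) (trans (F.distribˡ x y z) (∙-cong (f≈g _ _) (f≈g _ _)))
    ; distribʳ = λ x y z → trans (sym (f≈g _ _)) (trans (F.distribʳ x y z) (∙-cong (f≈g _ _) (f≈g _ _)))
    }
    where module F = Bilinear f-bilinear

  Series-abelianGroup : AbelianGroup a ℓ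
  Series-abelianGroup = Pointwise.abelianGroup ℕ G

  module S = AbelianGroup Series-abelianGroup

  open S public using ()
    renaming (Carrier to Series; _≈_ to infix 4 _≋_; _∙_ to infixl 6 _⊕_; _⁻¹ to infix 8 ⊖_; ε to 0ˢ)

  shift : Series → Series
  shift x zero    = ε
  shift x (suc n) = x n

  shift-cong : ∀ {x y} → x ≋ y → shift x ≋ shift y
  shift-cong x≋y zero    = refl
  shift-cong x≋y (suc n) = x≋y n

  shift-⊕ : ∀ x y → shift (x ⊕ y) ≋ shift x ⊕ shift y
  shift-⊕ x y zero    = sym (identityˡ ε)
  shift-⊕ x y (suc n) = refl

  shift-⊖ : ∀ x → shift (⊖ x) ≋ ⊖ shift x
  shift-⊖ x zero    = sym ε⁻¹≈ε
  shift-⊖ x (suc n) = refl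

  conv : (Carrier → Carrier → Carrier) → Series → Series → Series
  conv f x y n = sum n (λ i → f (x i) (y (n ∸ i)))

  conv-suc : ∀ f x y n → conv f x y (suc n) ≈ f (x 0) (y (suc n)) ∙ conv f (x ∘ suc) y n
  conv-suc f x y n = sum-suc n _

  conv-∙ : ∀ f g x y → conv (λ p q → f p q ∙ g p q) x y ≋ conv f x y ⊕ conv g x y
  conv-∙ f g x y n = sum-∙ n _ _

  conv-resp : ∀ {f g} → (∀ p q → f p q ≈ g p q) → ∀ x y → conv f x y ≋ conv g x y
  conv-resp f≈g x y n = sum-cong n (λ i → f≈g _ _)

  conv-homo : ∀ {f g} (h : Carrier → Carrier) → (∀ {x y} → x ≈ y → h x ≈ h y) →
              (∀ x y → h (x ∙ y) ≈ h x ∙ h y) → (∀ p q → h (f p q) ≈ g p q) →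
              ∀ x y n → h (conv f x y n) ≈ conv g x y n
  conv-homo h h-cong h-∙ hf≈g x y n =
    trans (sum-homo h h-cong h-∙ n _) (sum-cong n (λ i → hf≈g _ _))

  module _ {f : Carrier → Carrier → Carrier} (f-bilinear : Bilinear f) where
    open Bilinear f-bilinear

    conv-cong : ∀ {x x′ y y′} → x ≋ x′ → y ≋ y′ → conv f x y ≋ conv f x′ y′
    conv-cong x≋x′ y≋y′ n = sum-cong n (λ i → cong (x≋x′ i) (y≋y′ (n ∸ i)))

    conv-distribˡ : ∀ x y z → conv f x (y ⊕ z) ≋ conv f x y ⊕ conv f x z
    conv-distribˡ x y z n = trans (sum-cong n (λ i → distribˡ _ _ _)) (sum-∙ n _ _)

    conv-distribʳ : ∀ x y z → conv f (y ⊕ z) x ≋ conv f y x ⊕ conv f z x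
    conv-distribʳ x y z n = trans (sum-cong n (λ i → distribʳ _ _ _)) (sum-∙ n _ _)

    conv-⁻¹-homoˡ : ∀ x y → conv f (⊖ x) y ≋ ⊖ conv f x y
    conv-⁻¹-homoˡ x y n =
      trans (sum-cong n (λ i → ⁻¹-homoˡ _ _))
            (sym (sum-homo _⁻¹ ⁻¹-cong (λ p q → sym (⁻¹-∙-comm p q)) n _))

    conv-shiftˡ : ∀ x y → conv f (shift x) y ≋ shift (conv f x y)
    conv-shiftˡ x y zero    = zeroˡ _
    conv-shiftˡ x y (suc n) =
      trans (conv-suc f (shift x) y n) (trans (∙-cong (zeroˡ _) refl) (identityˡ _))

    conv-shiftʳ : ∀ x y → conv f x (shift y) ≋ shift (conv f x y)
    conv-shiftʳ x y zero          = zeroʳ _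
    conv-shiftʳ x y (suc zero)    =
      trans (conv-suc f x (shift y) 0) (trans (∙-cong refl (zeroʳ _)) (identityʳ _))
    conv-shiftʳ x y (suc (suc n)) =
      trans (conv-suc f x (shift y) (suc n))
            (trans (∙-cong refl (conv-shiftʳ (x ∘ suc) y (suc n)))
                   (sym (conv-suc f x y n)))

    conv-constˡ : ∀ x y → (∀ i → x (suc i) ≈ ε) → conv f x y ≋ λ n → f (x 0) (y n)
    conv-constˡ x y x≈ε zero    = refl
    conv-constˡ x y x≈ε (suc n) =
      trans (conv-suc f x y n)
            (trans (∙-cong refl (sum-ε n (λ i → trans (cong (x≈ε i) refl) (zeroˡ _))))
                   (identityʳ _))

    conv-constʳ : ∀ x y → (∀ i → y (suc i) ≈ ε) → conv f x y ≋ λ n → f (x n) (y 0)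
    conv-constʳ x y y≈ε zero    = refl
    conv-constʳ x y y≈ε (suc n) =
      trans (conv-suc f x y n)
            (trans (∙-cong (trans (cong refl (y≈ε n)) (zeroʳ _)) (conv-constʳ (x ∘ suc) y y≈ε n))
                   (identityˡ _))

  conv-assoc : ∀ {f g h k} → Bilinear g → Bilinear k →
               (∀ p q r → g (f p q) r ≈ k p (h q r)) →
               ∀ x y z → conv g (conv f x y) z ≋ conv k x (conv h y z)
  conv-assoc {f} {g} {h} {k} g-bilinear k-bilinear assoc-law x y z zero = assoc-law _ _ _
  conv-assoc {f} {g} {h} {k} g-bilinear k-bilinear assoc-law x y z (suc n) = begin
    conv g (conv f x y) z (suc n)
      ≈⟨ conv-suc g (conv f x y) z n ⟩
    g (f (x 0) (y 0)) (z (suc n)) ∙ conv g (conv f x y ∘ suc) z n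
      ≈⟨ ∙-cong (assoc-law _ _ _)
                (trans (conv-cong g-bilinear {y = z} {y′ = z} (λ j → conv-suc f x y j) (λ _ → refl) n)
                       (conv-distribʳ g-bilinear z _ _ n)) ⟩
    k (x 0) (h (y 0) (z (suc n)))
      ∙ (conv g (λ j → f (x 0) (y (suc j))) z n ∙ conv g (conv f (x ∘ suc) y) z n)
      ≈⟨ ∙-cong refl (∙-cong (trans (sum-cong n (λ i → assoc-law _ _ _)) (sym (k-sum n)))
                             (conv-assoc g-bilinear k-bilinear assoc-law (x ∘ suc) y z n)) ⟩
    k (x 0) (h (y 0) (z (suc n)))
      ∙ (k (x 0) (conv h (y ∘ suc) z n) ∙ conv k (x ∘ suc) (conv h y z) n)
      ≈⟨ sym (assoc _ _ _) ⟩
    (k (x 0) (h (y 0) (z (suc n))) ∙ k (x 0) (conv h (y ∘ suc) z n))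
      ∙ conv k (x ∘ suc) (conv h y z) n
      ≈⟨ ∙-cong (sym (trans (K.cong refl (conv-suc h y z n)) (K.distribˡ _ _ _))) refl ⟩
    k (x 0) (conv h y z (suc n)) ∙ conv k (x ∘ suc) (conv h y z) n
      ≈⟨ sym (conv-suc k x (conv h y z) n) ⟩
    conv k x (conv h y z) (suc n) ∎
    where
    module K = Bilinear k-bilinear
    k-sum : ∀ n {u : ℕ → Carrier} → k (x 0) (sum n u) ≈ sum n (λ i → k (x 0) (u i))
    k-sum n = sum-homo (k (x 0)) (K.cong refl) (K.distribˡ (x 0)) n _

module AugmentedSeries {c ℓ m ℓm} {F : Field c ℓ} (D : Dendriform F m ℓm) where
  module K = Field F
  open Dendriform D
  open Augmented D
  open CommutativeMonoidSolver +ᴹ-commutativeMonoid using (solve; _⊜_) renaming (_⊕_ to _⊞_)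
  open CommutativeSemigroupProperties (CommutativeMonoid.commutativeSemigroup +ᴹ-commutativeMonoid)
    using () renaming (interchange to +ᴹ-interchange)
  open GroupProperties +ᴹ-group using () renaming (identityˡ-unique to +ᴹ-identityˡ-unique)

  ≺-zeroʳ : ∀ x → x ≺ 0ᴹ ≈ᴹ 0ᴹ
  ≺-zeroʳ x = +ᴹ-identityˡ-unique _ _
    (≈ᴹ-trans (≈ᴹ-sym (≺-distribˡ x 0ᴹ 0ᴹ)) (≺-cong ≈ᴹ-refl (+ᴹ-identityˡ 0ᴹ)))

  ≺-zeroˡ : ∀ y → 0ᴹ ≺ y ≈ᴹ 0ᴹ
  ≺-zeroˡ y = +ᴹ-identityˡ-unique _ _
    (≈ᴹ-trans (≈ᴹ-sym (≺-distribʳ y 0ᴹ 0ᴹ)) (≺-cong (+ᴹ-identityˡ 0ᴹ) ≈ᴹ-refl))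

  ≻-zeroˡ : ∀ y → 0ᴹ ≻ y ≈ᴹ 0ᴹ
  ≻-zeroˡ y = +ᴹ-identityˡ-unique _ _
    (≈ᴹ-trans (≈ᴹ-sym (≻-distribʳ y 0ᴹ 0ᴹ)) (≻-cong (+ᴹ-identityˡ 0ᴹ) ≈ᴹ-refl))

  D̄-abelianGroup : AbelianGroup (c ⊔ m) (ℓ ⊔ ℓm)
  D̄-abelianGroup = DirectProduct.abelianGroup K.+-abelianGroup +ᴹ-abelianGroup

  module G = AbelianGroup D̄-abelianGroup
  open Convolution D̄-abelianGroup public

  0#≈0#+0# : K.0# K.≈ K.0# K.+ K.0#
  0#≈0#+0# = K.sym (K.+-identityˡ K.0#)

  -- Total versions of ≺ and ≻ on D̄, with values in D ⊆ D̄: the undefined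
  -- products 1 ≺ 1 and 1 ≻ 1 are set to 0, and ⊙ collects the k·1 part of *̄.
  infixl 7 _≺̃_ _≻̃_ _⊙_
  _≺̃_ _≻̃_ _⊙_ : D̄ → D̄ → D̄
  (_ , x) ≺̃ q       = ι (x ≺̄ q)
  p ≻̃ (_ , y)       = ι (p ≻̄ y)
  (α , _) ⊙ (β , _) = (α K.* β , 0ᴹ)

  π : D̄ → D̄
  π (_ , x) = ι x

  ≺̃-bilinear : Bilinear _≺̃_
  ≺̃-bilinear = record
    { cong     = λ { (_ , x≈x′) (β≈β′ , y≈y′) →
        K.refl , +ᴹ-cong (*ₗ-cong β≈β′ x≈x′) (≺-cong x≈x′ y≈y′) }
    ; distribˡ = λ { (_ , x) (β , y) (γ , z) → 0#≈0#+0# ,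
        ≈ᴹ-trans (+ᴹ-cong (*ₗ-distribʳ x β γ) (≺-distribˡ x y z)) (+ᴹ-interchange _ _ _ _) }
    ; distribʳ = λ { (β , y) (_ , x) (_ , x′) → 0#≈0#+0# ,
        ≈ᴹ-trans (+ᴹ-cong (*ₗ-distribˡ β x x′) (≺-distribʳ y x x′)) (+ᴹ-interchange _ _ _ _) }
    }

  ≻̃-bilinear : Bilinear _≻̃_
  ≻̃-bilinear = record
    { cong     = λ { (α≈α′ , x≈x′) (_ , y≈y′) →
        K.refl , +ᴹ-cong (*ₗ-cong α≈α′ y≈y′) (≻-cong x≈x′ y≈y′) }
    ; distribˡ = λ { (α , x) (_ , y) (_ , z) → 0#≈0#+0# ,
        ≈ᴹ-trans (+ᴹ-cong (*ₗ-distribˡ α y z) (≻-distribˡ x y z)) (+ᴹ-interchange _ _ _ _) }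
    ; distribʳ = λ { (_ , z) (α , x) (α′ , x′) → 0#≈0#+0# ,
        ≈ᴹ-trans (+ᴹ-cong (*ₗ-distribʳ z α α′) (≻-distribʳ z x x′)) (+ᴹ-interchange _ _ _ _) }
    }

  ⊙-bilinear : Bilinear _⊙_
  ⊙-bilinear = record
    { cong     = λ { (α≈α′ , _) (β≈β′ , _) → K.*-cong α≈α′ β≈β′ , ≈ᴹ-refl }
    ; distribˡ = λ { (α , _) (β , _) (γ , _) → K.distribˡ α β γ , ≈ᴹ-sym (+ᴹ-identityˡ 0ᴹ) }
    ; distribʳ = λ { (γ , _) (α , _) (β , _) → K.distribʳ γ α β , ≈ᴹ-sym (+ᴹ-identityˡ 0ᴹ) }
    }

  *̄-vector-part : ∀ α β x y →
    ((α *ₗ y) +ᴹ (β *ₗ x)) +ᴹ ((x ≺ y) +ᴹ (x ≻ y))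
      ≈ᴹ ((β *ₗ x) +ᴹ (x ≺ y)) +ᴹ ((α *ₗ y) +ᴹ (x ≻ y))
  *̄-vector-part α β x y =
    solve 4 (λ A B C E → (A ⊞ B) ⊞ (C ⊞ E) ⊜ (B ⊞ C) ⊞ (A ⊞ E)) ≈ᴹ-refl _ _ _ _

  *̄-split : ∀ p q → p *̄ q G.≈ (p ⊙ q) +̄ ((p ≺̃ q) +̄ (p ≻̃ q))
  *̄-split (α , x) (β , y) =
    K.sym (K.trans (K.+-congˡ (K.+-identityˡ K.0#)) (K.+-identityʳ _)) ,
    ≈ᴹ-trans (*̄-vector-part α β x y) (≈ᴹ-sym (+ᴹ-identityˡ _))

  π-*̄ : ∀ p q → π (p *̄ q) G.≈ (p ≺̃ q) +̄ (p ≻̃ q)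
  π-*̄ (α , x) (β , y) = 0#≈0#+0# , *̄-vector-part α β x y

  *̄-bilinear : Bilinear _*̄_
  *̄-bilinear = Bilinear-resp (λ p q → G.sym (*̄-split p q))
    (Bilinear-∙ ⊙-bilinear (Bilinear-∙ ≺̃-bilinear ≻̃-bilinear))

  ≺̃-≺̃ : ∀ p q r → (p ≺̃ q) ≺̃ r G.≈ p ≺̃ (q *̄ r)
  ≺̃-≺̃ (α , x) (β , y) (γ , z) = K.refl , (begin
    γ *ₗ (β *ₗ x +ᴹ x ≺ y) +ᴹ (β *ₗ x +ᴹ x ≺ y) ≺ z
      ≈⟨ +ᴹ-cong (*ₗ-distribˡ γ _ _) (≺-distribʳ z _ _) ⟩
    (γ *ₗ (β *ₗ x) +ᴹ γ *ₗ (x ≺ y)) +ᴹ ((β *ₗ x) ≺ z +ᴹ (x ≺ y) ≺ z)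
      ≈⟨ +ᴹ-congˡ (+ᴹ-cong (≺-scalarˡ β x z) (dend₁ x y z)) ⟩
    (γ *ₗ (β *ₗ x) +ᴹ γ *ₗ (x ≺ y)) +ᴹ (β *ₗ (x ≺ z) +ᴹ x ≺ (y ≺ z +ᴹ y ≻ z))
      ≈⟨ solve 4 (λ A B C E → (A ⊞ B) ⊞ (C ⊞ E) ⊜ A ⊞ ((C ⊞ B) ⊞ E)) ≈ᴹ-refl _ _ _ _ ⟩
    γ *ₗ (β *ₗ x) +ᴹ ((β *ₗ (x ≺ z) +ᴹ γ *ₗ (x ≺ y)) +ᴹ x ≺ (y ≺ z +ᴹ y ≻ z))
      ≈⟨ +ᴹ-cong (≈ᴹ-trans (*ₗ-comm γ β x) (≈ᴹ-sym (*ₗ-assoc β γ x)))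
                 (≈ᴹ-sym (≈ᴹ-trans (≺-distribˡ x _ _)
                   (+ᴹ-congʳ (≈ᴹ-trans (≺-distribˡ x _ _) (+ᴹ-cong (≺-scalarʳ β x z) (≺-scalarʳ γ x y)))))) ⟩
    (β K.* γ) *ₗ x +ᴹ x ≺ ((β *ₗ z +ᴹ γ *ₗ y) +ᴹ (y ≺ z +ᴹ y ≻ z)) ∎)
    where open SetoidReasoning ≈ᴹ-setoid

  ≻̃-≺̃ : ∀ p q r → (p ≻̃ q) ≺̃ r G.≈ p ≻̃ (q ≺̃ r)
  ≻̃-≺̃ (α , x) (β , y) (γ , z) = K.refl , (begin
    γ *ₗ (α *ₗ y +ᴹ x ≻ y) +ᴹ (α *ₗ y +ᴹ x ≻ y) ≺ z
      ≈⟨ +ᴹ-cong (*ₗ-distribˡ γ _ _) (≺-distribʳ z _ _) ⟩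
    (γ *ₗ (α *ₗ y) +ᴹ γ *ₗ (x ≻ y)) +ᴹ ((α *ₗ y) ≺ z +ᴹ (x ≻ y) ≺ z)
      ≈⟨ +ᴹ-congˡ (+ᴹ-cong (≺-scalarˡ α y z) (dend₂ x y z)) ⟩
    (γ *ₗ (α *ₗ y) +ᴹ γ *ₗ (x ≻ y)) +ᴹ (α *ₗ (y ≺ z) +ᴹ x ≻ (y ≺ z))
      ≈⟨ +ᴹ-interchange _ _ _ _ ⟩
    (γ *ₗ (α *ₗ y) +ᴹ α *ₗ (y ≺ z)) +ᴹ (γ *ₗ (x ≻ y) +ᴹ x ≻ (y ≺ z))
      ≈⟨ ≈ᴹ-sym (+ᴹ-cong (+ᴹ-congʳ (*ₗ-comm α γ y)) (+ᴹ-congʳ (≻-scalarʳ γ x y))) ⟩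
    (α *ₗ (γ *ₗ y) +ᴹ α *ₗ (y ≺ z)) +ᴹ (x ≻ (γ *ₗ y) +ᴹ x ≻ (y ≺ z))
      ≈⟨ ≈ᴹ-sym (+ᴹ-cong (*ₗ-distribˡ α _ _) (≻-distribˡ x _ _)) ⟩
    α *ₗ (γ *ₗ y +ᴹ y ≺ z) +ᴹ x ≻ (γ *ₗ y +ᴹ y ≺ z) ∎)
    where open SetoidReasoning ≈ᴹ-setoid

  ≻̃-≻̃ : ∀ p q r → p ≻̃ (q ≻̃ r) G.≈ (p *̄ q) ≻̃ r
  ≻̃-≻̃ (α , x) (β , y) (γ , z) = K.refl , (begin
    α *ₗ (β *ₗ z +ᴹ y ≻ z) +ᴹ x ≻ (β *ₗ z +ᴹ y ≻ z)
      ≈⟨ +ᴹ-cong (*ₗ-distribˡ α _ _) (≻-distribˡ x _ _) ⟩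
    (α *ₗ (β *ₗ z) +ᴹ α *ₗ (y ≻ z)) +ᴹ (x ≻ (β *ₗ z) +ᴹ x ≻ (y ≻ z))
      ≈⟨ +ᴹ-congˡ (+ᴹ-cong (≻-scalarʳ β x z) (dend₃ x y z)) ⟩
    (α *ₗ (β *ₗ z) +ᴹ α *ₗ (y ≻ z)) +ᴹ (β *ₗ (x ≻ z) +ᴹ (x ≺ y +ᴹ x ≻ y) ≻ z)
      ≈⟨ solve 4 (λ A B C E → (A ⊞ B) ⊞ (C ⊞ E) ⊜ A ⊞ ((B ⊞ C) ⊞ E)) ≈ᴹ-refl _ _ _ _ ⟩
    α *ₗ (β *ₗ z) +ᴹ ((α *ₗ (y ≻ z) +ᴹ β *ₗ (x ≻ z)) +ᴹ (x ≺ y +ᴹ x ≻ y) ≻ z)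
      ≈⟨ ≈ᴹ-sym (+ᴹ-cong (*ₗ-assoc α β z) (≈ᴹ-trans (≻-distribʳ z _ _)
           (+ᴹ-congʳ (≈ᴹ-trans (≻-distribʳ z _ _) (+ᴹ-cong (≻-scalarˡ α y z) (≻-scalarˡ β x z)))))) ⟩
    (α K.* β) *ₗ z +ᴹ ((α *ₗ y +ᴹ β *ₗ x) +ᴹ (x ≺ y +ᴹ x ≻ y)) ≻ z ∎)
    where open SetoidReasoning ≈ᴹ-setoid

  *̄-assoc : ∀ p q r → (p *̄ q) *̄ r G.≈ p *̄ (q *̄ r)
  *̄-assoc p q r = begin
    (p *̄ q) *̄ r
      ≈⟨ *̄-split _ _ ⟩
    ((p *̄ q) ⊙ r) +̄ (((p *̄ q) ≺̃ r) +̄ ((p *̄ q) ≻̃ r))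
      ≈⟨ G.∙-cong (K.*-assoc _ _ _ , ≈ᴹ-refl) (G.∙-cong ≺-part (G.sym (≻̃-≻̃ p q r))) ⟩
    (p ⊙ (q *̄ r)) +̄ (((p ≺̃ (q *̄ r)) +̄ (p ≻̃ (q ≺̃ r))) +̄ (p ≻̃ (q ≻̃ r)))
      ≈⟨ G.∙-congˡ (G.assoc _ _ _) ⟩
    (p ⊙ (q *̄ r)) +̄ ((p ≺̃ (q *̄ r)) +̄ ((p ≻̃ (q ≺̃ r)) +̄ (p ≻̃ (q ≻̃ r))))
      ≈⟨ G.∙-congˡ (G.∙-congˡ ≻-part) ⟩
    (p ⊙ (q *̄ r)) +̄ ((p ≺̃ (q *̄ r)) +̄ (p ≻̃ (q *̄ r)))
      ≈⟨ G.sym (*̄-split _ _) ⟩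
    p *̄ (q *̄ r) ∎
    where
    open SetoidReasoning G.setoid
    module ≺̃ = Bilinear ≺̃-bilinear
    module ≻̃ = Bilinear ≻̃-bilinear
    -- ≺̃ only sees the D-part of its left argument, ≻̃ that of its right one.
    ≺-part : (p *̄ q) ≺̃ r G.≈ (p ≺̃ (q *̄ r)) +̄ (p ≻̃ (q ≺̃ r))
    ≺-part = G.trans (≺̃.cong (π-*̄ p q) G.refl)
               (G.trans (≺̃.distribʳ r (p ≺̃ q) (p ≻̃ q)) (G.∙-cong (≺̃-≺̃ p q r) (≻̃-≺̃ p q r)))
    ≻-part : (p ≻̃ (q ≺̃ r)) +̄ (p ≻̃ (q ≻̃ r)) G.≈ p ≻̃ (q *̄ r)
    ≻-part = G.sym (G.trans (≻̃.cong G.refl (π-*̄ q r)) (≻̃.distribˡ p (q ≺̃ r) (q ≻̃ r)))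

  ≺̃-identityʳ : ∀ p → p ≺̃ 1̄ G.≈ π p
  ≺̃-identityʳ (_ , x) = K.refl , ≈ᴹ-trans (+ᴹ-cong (*ₗ-identityˡ x) (≺-zeroʳ x)) (+ᴹ-identityʳ x)

  ≻̃-identityˡ : ∀ q → 1̄ ≻̃ q G.≈ π q
  ≻̃-identityˡ (_ , y) = K.refl , ≈ᴹ-trans (+ᴹ-cong (*ₗ-identityˡ y) (≻-zeroˡ y)) (+ᴹ-identityʳ y)

  *̄-identityˡ : ∀ q → 1̄ *̄ q G.≈ q
  *̄-identityˡ (β , y) = K.*-identityˡ β ,
    ≈ᴹ-trans (+ᴹ-cong (+ᴹ-cong (*ₗ-identityˡ y) (*ₗ-zeroʳ β)) (+ᴹ-cong (≺-zeroˡ y) (≻-zeroˡ y)))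
      (≈ᴹ-trans (+ᴹ-cong (+ᴹ-identityʳ y) (+ᴹ-identityˡ 0ᴹ)) (+ᴹ-identityʳ y))

  ⊙-πˡ : ∀ p q → π p ⊙ q G.≈ 0̄
  ⊙-πˡ p q = K.zeroˡ _ , ≈ᴹ-refl

  ⊙-πʳ : ∀ p q → p ⊙ π q G.≈ 0̄
  ⊙-πʳ p q = K.zeroʳ _ , ≈ᴹ-refl

  π-cong : ∀ {p q} → p G.≈ q → π p G.≈ π q
  π-cong (_ , x≈y) = K.refl , x≈y

  π-+̄ : ∀ p q → π (p +̄ q) G.≈ π p +̄ π q
  π-+̄ p q = 0#≈0#+0# , ≈ᴹ-refl

  infixl 7 _⋆_ _⋖_ _⋗_
  _⋆_ _⋖_ _⋗_ : Series → Series → Series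
  _⋆_ = conv _*̄_
  _⋖_ = conv _≺̃_
  _⋗_ = conv _≻̃_

  πˢ : Series → Series
  πˢ x n = π (x n)

  InD : Series → Set (ℓ ⊔ ℓm)
  InD x = πˢ x ≋ x

  ⋆-cong : ∀ {x x′ y y′} → x ≋ x′ → y ≋ y′ → x ⋆ y ≋ x′ ⋆ y′
  ⋆-cong = conv-cong *̄-bilinear

  ⋖-cong : ∀ {x x′ y y′} → x ≋ x′ → y ≋ y′ → x ⋖ y ≋ x′ ⋖ y′
  ⋖-cong = conv-cong ≺̃-bilinear

  ⋗-cong : ∀ {x x′ y y′} → x ≋ x′ → y ≋ y′ → x ⋗ y ≋ x′ ⋗ y′
  ⋗-cong = conv-cong ≻̃-bilinear

  ⋆-assoc : ∀ x y z → (x ⋆ y) ⋆ z ≋ x ⋆ (y ⋆ z)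
  ⋆-assoc = conv-assoc *̄-bilinear *̄-bilinear *̄-assoc

  ⋖-⋆ : ∀ x y z → (x ⋖ y) ⋖ z ≋ x ⋖ (y ⋆ z)
  ⋖-⋆ = conv-assoc ≺̃-bilinear ≺̃-bilinear ≺̃-≺̃

  ⋆-⋗ : ∀ x y z → (x ⋆ y) ⋗ z ≋ x ⋗ (y ⋗ z)
  ⋆-⋗ = conv-assoc ≻̃-bilinear ≻̃-bilinear (λ p q r → G.sym (≻̃-≻̃ p q r))

  ⋗-πˢ : ∀ x y → x ⋗ πˢ y ≋ x ⋗ y
  ⋗-πˢ x y n = G.refl

  InD-⋖ : ∀ x y → InD (x ⋖ y)
  InD-⋖ = conv-homo {_≺̃_} {_≺̃_} π π-cong π-+̄ (λ p q → G.refl)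

  InD-⋗ : ∀ x y → InD (x ⋗ y)
  InD-⋗ = conv-homo {_≻̃_} {_≻̃_} π π-cong π-+̄ (λ p q → G.refl)

  π-⋆ : ∀ x y → πˢ (x ⋆ y) ≋ x ⋖ y ⊕ x ⋗ y
  π-⋆ x y n = G.trans (conv-homo {_*̄_} {λ p q → (p ≺̃ q) +̄ (p ≻̃ q)} π π-cong π-+̄ π-*̄ x y n)
                      (conv-∙ _≺̃_ _≻̃_ x y n)

  ⋆-split : ∀ x y → x ⋆ y ≋ conv _⊙_ x y ⊕ (x ⋖ y ⊕ x ⋗ y)
  ⋆-split x y n = G.trans (conv-resp {_*̄_} {λ p q → (p ⊙ q) +̄ ((p ≺̃ q) +̄ (p ≻̃ q))} *̄-split x y n)
    (G.trans (conv-∙ _⊙_ (λ p q → (p ≺̃ q) +̄ (p ≻̃ q)) x y n)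
             (G.∙-congˡ (conv-∙ _≺̃_ _≻̃_ x y n)))

  ⋆-split-scalarFree : ∀ x y → (∀ i j → x i ⊙ y j G.≈ 0̄) → x ⋆ y ≋ x ⋖ y ⊕ x ⋗ y
  ⋆-split-scalarFree x y ⊙≈0 n =
    G.trans (⋆-split x y n) (G.trans (G.∙-congʳ (sum-ε n (λ i → ⊙≈0 _ _))) (G.identityˡ _))

  ⋆-splitˡ : ∀ {x} y → InD x → x ⋆ y ≋ x ⋖ y ⊕ x ⋗ y
  ⋆-splitˡ {x} y x∈D = ⋆-split-scalarFree x y
    (λ i j → G.trans (⊙.cong {y = y j} (G.sym (x∈D i)) G.refl) (⊙-πˡ (x i) (y j)))
    where module ⊙ = Bilinear ⊙-bilinear

  ⋆-splitʳ : ∀ x {y} → InD y → x ⋆ y ≋ x ⋖ y ⊕ x ⋗ y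
  ⋆-splitʳ x {y} y∈D = ⋆-split-scalarFree x y
    (λ i j → G.trans (⊙.cong {x = x i} G.refl (G.sym (y∈D j))) (⊙-πʳ (x i) (y j)))
    where module ⊙ = Bilinear ⊙-bilinear

  ⋖-oneˢ : ∀ x → x ⋖ oneˢ ≋ πˢ x
  ⋖-oneˢ x n = G.trans (conv-constʳ ≺̃-bilinear x oneˢ (λ _ → G.refl) n) (≺̃-identityʳ (x n))

  oneˢ-⋗ : ∀ y → oneˢ ⋗ y ≋ πˢ y
  oneˢ-⋗ y n = G.trans (conv-constˡ ≻̃-bilinear oneˢ y (λ _ → G.refl) n) (≻̃-identityˡ (y n))

  oneˢ-⋆ : ∀ y → oneˢ ⋆ y ≋ y
  oneˢ-⋆ y n = G.trans (conv-constˡ *̄-bilinear oneˢ y (λ _ → G.refl) n) (*̄-identityˡ (y n))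

  π-oneˢ : πˢ oneˢ ≋ 0ˢ
  π-oneˢ zero    = G.refl
  π-oneˢ (suc n) = G.refl

  sum̄≈sum : ∀ n f → sum̄ n f G.≈ sum n f
  sum̄≈sum zero    f = G.refl
  sum̄≈sum (suc n) f = G.∙-congʳ (sum̄≈sum n f)

  ι-sumᴹ : ∀ n f → ι (sumᴹ n f) G.≈ sum n (ι ∘ f)
  ι-sumᴹ zero    f = G.refl
  ι-sumᴹ (suc n) f = G.trans (0#≈0#+0# , ≈ᴹ-refl) (G.∙-congʳ (ι-sumᴹ n f))

  *ˢ≋⋆ : ∀ X Y → X *ˢ Y ≋ X ⋆ Y
  *ˢ≋⋆ X Y n = sum̄≈sum n _

  ι-≻ˢ : ∀ X A → ιˢ (X ≻ˢ A) ≋ X ⋗ ιˢ A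
  ι-≻ˢ X A n = ι-sumᴹ n _

  ι-≺ˢ : ∀ A X → ιˢ (A ≺ˢ X) ≋ ιˢ A ⋖ X
  ι-≺ˢ A X n = ι-sumᴹ n _

  ι-λ· : ∀ A → ιˢ (λ· A) ≋ shift (ιˢ A)
  ι-λ· A zero    = G.refl
  ι-λ· A (suc n) = G.refl

  ι-+ᴰ : ∀ A B → ιˢ (A +ᴰ B) ≋ ιˢ A ⊕ ιˢ B
  ι-+ᴰ A B n = 0#≈0#+0# , ≈ᴹ-refl

  ι-▷ˢ : ∀ X B → ιˢ (X ▷ˢ B) ≋ X ⋗ ιˢ B ⊕ ⊖ (ιˢ B ⋖ X)
  ι-▷ˢ X B n = G.trans (K.sym (K.trans (K.+-congˡ -0#≈0#) (K.+-identityˡ K.0#)) , ≈ᴹ-refl)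
                       (G.∙-cong (ι-≻ˢ X B n) (G.⁻¹-cong (ι-≺ˢ B X n)))
    where open GroupProperties K.+-group using () renaming (ε⁻¹≈ε to -0#≈0#)

  π-shift : ∀ x → πˢ (shift x) ≋ shift (πˢ x)
  π-shift x zero    = G.refl
  π-shift x (suc n) = G.refl

  preLie : Series → Series → Series → Series
  preLie A X B = A ⊕ shift (X ⋗ B ⊕ ⊖ (B ⋖ X))

  preLie-cong : ∀ A {X X′} B → X ≋ X′ → preLie A X B ≋ preLie A X′ B
  preLie-cong A B X≋X′ =
    S.∙-congˡ (shift-cong (S.∙-cong (⋗-cong {y = B} X≋X′ S.refl)
                                    (S.⁻¹-cong (⋖-cong {x = B} S.refl X≋X′))))

  ι-preLie : ∀ A X B → ιˢ (A +ᴰ (λ· (X ▷ˢ B))) ≋ preLie (ιˢ A) X (ιˢ B)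
  ι-preLie A X B =
    S.trans (ι-+ᴰ A _) (S.∙-congˡ (S.trans (ι-λ· _) (shift-cong (ι-▷ˢ X B))))

  module PreLieSolution (A B : SerD) (Z Y : Series)
    (Z-rec : Z ≋ oneˢ ⊕ shift (Z ⋗ ιˢ B)) (ZY : Z ⋆ Y ≋ oneˢ) (YZ : Y ⋆ Z ≋ oneˢ) where
    open SetoidReasoning S.setoid
    open CommutativeSemigroupProperties S.commutativeSemigroup using (x∙yz≈y∙zx)
    open GroupProperties S.group using (inverseˡ-unique)

    πZ : πˢ Z ≋ shift (Z ⋗ ιˢ B)
    πZ = begin
      πˢ Z
        ≈⟨ π-cong ∘ Z-rec ⟩
      πˢ (oneˢ ⊕ shift (Z ⋗ ιˢ B))
        ≈⟨ (λ n → π-+̄ (oneˢ n) (shift (Z ⋗ ιˢ B) n)) ⟩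
      πˢ oneˢ ⊕ πˢ (shift (Z ⋗ ιˢ B))
        ≈⟨ S.∙-cong π-oneˢ (S.trans (π-shift _) (shift-cong (InD-⋗ Z (ιˢ B)))) ⟩
      0ˢ ⊕ shift (Z ⋗ ιˢ B)
        ≈⟨ S.identityˡ _ ⟩
      shift (Z ⋗ ιˢ B) ∎

    ⋗-Z : ∀ x → x ⋗ Z ≋ shift ((x ⋆ Z) ⋗ ιˢ B)
    ⋗-Z x = begin
      x ⋗ Z                     ≈⟨ S.sym (⋗-πˢ x Z) ⟩
      x ⋗ πˢ Z                  ≈⟨ ⋗-cong {x = x} S.refl πZ ⟩
      x ⋗ shift (Z ⋗ ιˢ B)      ≈⟨ conv-shiftʳ ≻̃-bilinear x _ ⟩
      shift (x ⋗ (Z ⋗ ιˢ B))    ≈⟨ shift-cong (S.sym (⋆-⋗ x Z (ιˢ B))) ⟩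
      shift ((x ⋆ Z) ⋗ ιˢ B)    ∎

    W V X : Series
    W = (Z ⋗ ιˢ A) ⋖ Y
    V = W ⋆ Z
    X = (Y ⋆ W) ⋆ Z

    W⋖Z : W ⋖ Z ≋ Z ⋗ ιˢ A
    W⋖Z = begin
      ((Z ⋗ ιˢ A) ⋖ Y) ⋖ Z    ≈⟨ ⋖-⋆ (Z ⋗ ιˢ A) Y Z ⟩
      (Z ⋗ ιˢ A) ⋖ (Y ⋆ Z)    ≈⟨ ⋖-cong {x = Z ⋗ ιˢ A} S.refl YZ ⟩
      (Z ⋗ ιˢ A) ⋖ oneˢ       ≈⟨ ⋖-oneˢ (Z ⋗ ιˢ A) ⟩
      πˢ (Z ⋗ ιˢ A)           ≈⟨ InD-⋗ Z (ιˢ A) ⟩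
      Z ⋗ ιˢ A                ∎

    V-split : V ≋ W ⋖ Z ⊕ W ⋗ Z
    V-split = ⋆-splitˡ Z (InD-⋖ (Z ⋗ ιˢ A) Y)

    V-rec : V ≋ Z ⋗ ιˢ A ⊕ shift (V ⋗ ιˢ B)
    V-rec = S.trans V-split (S.∙-cong W⋖Z (⋗-Z W))

    V∈D : InD V
    V∈D = S.trans (π-⋆ W Z) (S.sym V-split)

    Z⋆X : Z ⋆ X ≋ V
    Z⋆X = begin
      Z ⋆ ((Y ⋆ W) ⋆ Z)    ≈⟨ ⋆-cong {x = Z} S.refl (⋆-assoc Y W Z) ⟩
      Z ⋆ (Y ⋆ V)          ≈⟨ S.sym (⋆-assoc Z Y V) ⟩
      (Z ⋆ Y) ⋆ V          ≈⟨ ⋆-cong {y = V} ZY S.refl ⟩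
      oneˢ ⋆ V             ≈⟨ oneˢ-⋆ V ⟩
      V                    ∎

    Y⋗Z : Y ⋗ Z ≋ shift (ιˢ B)
    Y⋗Z = begin
      Y ⋗ Z                     ≈⟨ ⋗-Z Y ⟩
      shift ((Y ⋆ Z) ⋗ ιˢ B)    ≈⟨ shift-cong (⋗-cong {y = ιˢ B} YZ S.refl) ⟩
      shift (oneˢ ⋗ ιˢ B)       ≈⟨ shift-cong (oneˢ-⋗ (ιˢ B)) ⟩
      shift (ιˢ B)              ∎

    -- The D-part of Y ⋆ Z = 1 vanishes.
    Y⋖Z : Y ⋖ Z ≋ ⊖ shift (ιˢ B)
    Y⋖Z = S.trans (inverseˡ-unique _ _ D-part) (S.⁻¹-cong Y⋗Z)
      where
      D-part : Y ⋖ Z ⊕ Y ⋗ Z ≋ 0ˢ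
      D-part = S.trans (S.sym (π-⋆ Y Z)) (S.trans (π-cong ∘ YZ) π-oneˢ)

    Y⋖V : Y ⋖ V ≋ ⊖ shift (ιˢ B ⋖ X)
    Y⋖V = begin
      Y ⋖ V                  ≈⟨ ⋖-cong {x = Y} S.refl (S.sym Z⋆X) ⟩
      Y ⋖ (Z ⋆ X)            ≈⟨ S.sym (⋖-⋆ Y Z X) ⟩
      (Y ⋖ Z) ⋖ X            ≈⟨ ⋖-cong {y = X} Y⋖Z S.refl ⟩
      (⊖ shift (ιˢ B)) ⋖ X   ≈⟨ conv-⁻¹-homoˡ ≺̃-bilinear (shift (ιˢ B)) X ⟩
      ⊖ (shift (ιˢ B) ⋖ X)   ≈⟨ S.⁻¹-cong (conv-shiftˡ ≺̃-bilinear _ X) ⟩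
      ⊖ shift (ιˢ B ⋖ X)     ∎

    Y⋗V : Y ⋗ V ≋ ιˢ A ⊕ shift (X ⋗ ιˢ B)
    Y⋗V = begin
      Y ⋗ V
        ≈⟨ ⋗-cong {x = Y} S.refl V-rec ⟩
      Y ⋗ (Z ⋗ ιˢ A ⊕ shift (V ⋗ ιˢ B))
        ≈⟨ conv-distribˡ ≻̃-bilinear Y (Z ⋗ ιˢ A) (shift (V ⋗ ιˢ B)) ⟩
      Y ⋗ (Z ⋗ ιˢ A) ⊕ Y ⋗ shift (V ⋗ ιˢ B)
        ≈⟨ S.∙-cong (S.sym (⋆-⋗ Y Z (ιˢ A))) (conv-shiftʳ ≻̃-bilinear Y (V ⋗ ιˢ B)) ⟩
      (Y ⋆ Z) ⋗ ιˢ A ⊕ shift (Y ⋗ (V ⋗ ιˢ B))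
        ≈⟨ S.∙-cong (⋗-cong {y = ιˢ A} YZ S.refl) (shift-cong (S.sym (⋆-⋗ Y V (ιˢ B)))) ⟩
      oneˢ ⋗ ιˢ A ⊕ shift ((Y ⋆ V) ⋗ ιˢ B)
        ≈⟨ S.∙-cong (oneˢ-⋗ (ιˢ A))
                    (shift-cong (⋗-cong {y = ιˢ B} (S.sym (⋆-assoc Y W Z)) S.refl)) ⟩
      ιˢ A ⊕ shift (X ⋗ ιˢ B) ∎

    X-solves : X ≋ preLie (ιˢ A) X (ιˢ B)
    X-solves = begin
      X
        ≈⟨ ⋆-assoc Y W Z ⟩
      Y ⋆ V
        ≈⟨ ⋆-splitʳ Y V∈D ⟩
      Y ⋖ V ⊕ Y ⋗ V
        ≈⟨ S.∙-cong Y⋖V Y⋗V ⟩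
      ⊖ shift (ιˢ B ⋖ X) ⊕ (ιˢ A ⊕ shift (X ⋗ ιˢ B))
        ≈⟨ x∙yz≈y∙zx _ _ _ ⟩
      ιˢ A ⊕ (shift (X ⋗ ιˢ B) ⊕ ⊖ shift (ιˢ B ⋖ X))
        ≈⟨ S.∙-congˡ (S.sym (S.trans (shift-⊕ _ _) (S.∙-congˡ (shift-⊖ _)))) ⟩
      ιˢ A ⊕ shift (X ⋗ ιˢ B ⊕ ⊖ (ιˢ B ⋖ X)) ∎

mainTheorem4 : ∀ {c ℓ m ℓm} (F : Field c ℓ) → CharZero F →
    (D : Dendriform F m ℓm) →
    let open Augmented D in
    (a b : Dendriform.Carrierᴹ D) (Z Zinv : Ser) →
    Z ≈ˢ oneˢ +ˢ ιˢ (λ· (Z ≻ˢ constᴰ b)) →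
    (Z *ˢ Zinv ≈ˢ oneˢ) × (Zinv *ˢ Z ≈ˢ oneˢ) →
    let X = (Zinv *ˢ ιˢ ((Z ≻ˢ constᴰ a) ≺ˢ Zinv)) *ˢ Z in
    X ≈ˢ ιˢ (constᴰ a +ᴰ (λ· (X ▷ˢ constᴰ b)))
mainTheorem4 F _ D a b Z Zinv Z-rec (Z*Zinv , Zinv*Z) = begin
  X′                       ≈⟨ X′≋X ⟩
  X                        ≈⟨ X-solves ⟩
  preLie (ιˢ A) X (ιˢ B)   ≈⟨ preLie-cong (ιˢ A) (ιˢ B) (S.sym X′≋X) ⟩
  preLie (ιˢ A) X′ (ιˢ B)  ≈⟨ S.sym (ι-preLie A X′ B) ⟩
  ιˢ (A +ᴰ (λ· (X′ ▷ˢ B)))  ∎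
  where
  open Augmented D
  open AugmentedSeries D
  open SetoidReasoning S.setoid
  A B : SerD
  A = constᴰ a
  B = constᴰ b
  open PreLieSolution A B Z Zinv
    (S.trans Z-rec (S.∙-congˡ (S.trans (ι-λ· _) (shift-cong (ι-≻ˢ Z B)))))
    (S.trans (S.sym (*ˢ≋⋆ Z Zinv)) Z*Zinv)
    (S.trans (S.sym (*ˢ≋⋆ Zinv Z)) Zinv*Z)
  X′ : Series
  X′ = (Zinv *ˢ ιˢ ((Z ≻ˢ A) ≺ˢ Zinv)) *ˢ Z
  X′≋X : X′ ≋ X
  X′≋X = S.trans (*ˢ≋⋆ (Zinv *ˢ ιˢ ((Z ≻ˢ A) ≺ˢ Zinv)) Z) (⋆-cong {y = Z}
    (S.trans (*ˢ≋⋆ Zinv (ιˢ ((Z ≻ˢ A) ≺ˢ Zinv))) (⋆-cong {x = Zinv} S.refl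
      (S.trans (ι-≺ˢ (Z ≻ˢ A) Zinv) (⋖-cong {y = Zinv} (ι-≻ˢ Z A) S.refl))))
    S.refl)
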